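{- Let $(Q,\rightarrow)$ be a finite transition system, $\mathscr{R}$ a preorder on $Q$ and $\mathscr{P}\subseteq\mathscr{R}$ an equivalence relation whose blocks have fixed representatives, such that there is no $(\mathscr{P},\mathscr{R})$-splitter transition of type 1. Let $E\rightarrow B$ be a $(\mathscr{P},\mathscr{R})$-splitter transition of type 2, and let $P'=\mathrm{Split}(P_{\mathscr{P}},E\cap\rightarrow^{ -1}(B))$. Then the equivalence relation $\mathscr{P}_{P'}$ is strictly included in $\mathscr{P}$ and contains every $\mathscr{R}$-block-stable equivalence relation included in $\mathscr{P}$.
   Context: Composition: $\mathscr{S}\circ\mathscr{R}=\{(x,y)\mid\exists z,(x,z)\in\mathscr{R},(z,y)\in\mathscr{S}\}$; $\mathscr{R}(X)=\{y\mid\exists x\in X,\ x\,\mathscr{R}\,y\}$; $\rightarrow^{ -1}(B)=\{q\mid\exists b\in B,\ q\rightarrow b\}$. Blocks of a preorder $\mathscr{R}$: $[q]_{\mathscr{R}}=\{q'\mid q\,\mathscr{R}\,q'\wedge q'\,\mathscr{R}\,q\}$; $P_{\mathscr{P}}$ is the partition into blocks of $\mathscr{P}$ and for a partition $P$, $\mathscr{P}_P=\bigcup_{E\in P}E\times E$. Each block $E$ of $\mathscr{P}$ has a fixed representative $E.\mathit{rep}\in E$. $X\,\mathscr{R}\,Y$ means $(X\times Y)\cap\mathscr{R}\ne\emptyset$; $X\rightarrow Y$ means some $x\in X,y\in Y$ with $x\rightarrow y$. $\mathrm{RelCount}_{(\mathscr{P},\mathscr{R})}(E,B)=|\{E'\text{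 block of }\mathscr{P}\mid E.\mathit{rep}\rightarrow E'\wedge B\,\mathscr{R}\,E'\}|$. A splitter transition of type 1 is a pair $(E,B)$, $E$ a block of $\mathscr{P}$, $B$ a block of $\mathscr{R}$, with $E\rightarrow B$ and $\mathrm{RelCount}_{(\mathscr{P},\mathscr{R})}(E,B)=0$. A splitter transition of type 2 is a pair $(E,B)$, $E$ a block of $\mathscr{P}$, $B$ a block of $\mathscr{R}$, with $E.\mathit{rep}\rightarrow B$, $\mathrm{RelCount}_{(\mathscr{P},\mathscr{R})}(E,B)=|\{[b]_{\mathscr{P}}\subseteq B\mid E.\mathit{rep}\rightarrow b\}|$, and $E\not\subseteq\rightarrow^{ -1}(B)$. $\mathrm{Split}(P,M)$ replaces each block $E$ of $P$ with $E\cap M\ne\emptyset$ and $E\not\subseteq M$ by $E\cap M$ and $E\setminus M$. An equivalence relation $\mathscr{P}\subseteq\mathscr{R}$ is $\mathscr{R}$-block-stable if for all $b,d,d'$, $d\,\mathscr{P}\,d'$ implies ($d\in(\rightarrow^{ -1}\circ\mathscr{R})(b)\iff d'\in(\rightarrow^{ -1}\circ\mathscr{R})(b)$). -}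

module Defs where

open import Data.Nat using (ℕ)
open import Data.Fin using (Fin; _≟_)
open import Data.Bool using (Bool; true; false; _∧_; _∨_; not; T; if_then_else_)
open import Data.List using (allFin; map)
open import Data.Bool.ListAction using (any; all)
open import Data.Nat.ListAction using (sum)
open import Data.Sum using (_⊎_)
open import Data.Product using (Σ; _×_)
open import Relation.Nullary using (¬_)
open import Relation.Nullary.Decidable using (⌊_⌋)
open import Relation.Binary.PropositionalEquality using (_≡_)
open import Relation.Binary.Structures using (IsEquivalence; IsPreorder)
open import Level using (0ℓ)

BRel : ℕ → Set
BRel n = Fin n → Fin n → Bool

anyF : ∀ {n} → (Fin n → Bool) → Bool
anyF {n} f = any f (allFin n)

allF : ∀ {n} → (Fin n → Bool) → Bool
allF {n} f = all f (allFin n)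

countF : ∀ {n} → (Fin n → Bool) → ℕ
countF {n} f = sum (map (λ x → if f x then 1 else 0) (allFin n))

record Reps {n} (P : BRel n) : Set where
  field
    rep    : Fin n → Fin n
    rep-in : ∀ q → T (P q (rep q))
    rep-eq : ∀ q q' → T (P q q') → rep q ≡ rep q'
open Reps public

module _ {n : ℕ} (t R P : BRel n) (ρ : Reps P) where

  -- a block E of P is identified with [e]_P, a block B of R with [b]_R.
  -- canonical elements c (rep c ≡ c) enumerate the blocks of P, each exactly once.
  isCanon : Fin n → Bool
  isCanon c = ⌊ rep ρ c ≟ c ⌋

  inB : Fin n → Fin n → Bool
  inB b x = R b x ∧ R x b

  BlockTo : Fin n → Fin n → Set
  BlockTo e b = Σ (Fin n) λ x → Σ (Fin n) λ y → T (P e x) × T (inB b y) × T (t x y)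

  -- RelCount(E,B) = |{E' block of P | E.rep → E' ∧ B R E'}|
  RelCount : Fin n → Fin n → ℕ
  RelCount e b = countF λ c → isCanon c
                              ∧ anyF (λ x → P c x ∧ t (rep ρ e) x)
                              ∧ anyF (λ y → anyF (λ x → inB b y ∧ P c x ∧ R y x))

  -- |{[b']_P ⊆ B | E.rep → b'}|
  RepSuccBlocksInB : Fin n → Fin n → ℕ
  RepSuccBlocksInB e b = countF λ c → isCanon c
                                      ∧ allF (λ x → not (P c x) ∨ inB b x)
                                      ∧ anyF (λ y → P c y ∧ t (rep ρ e) y)

  SplitterType1 : Fin n → Fin n → Set
  SplitterType1 e b = BlockTo e b × RelCount e b ≡ 0

  PreB : Fin n → Fin n → Set
  PreB b x = Σ (Fin n) λ y → T (inB b y) × T (t x y)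

  SplitterType2 : Fin n → Fin n → Set
  SplitterType2 e b =
    (Σ (Fin n) λ y → T (inB b y) × T (t (rep ρ e) y))
    × RelCount e b ≡ RepSuccBlocksInB e b
    × (Σ (Fin n) λ x → T (P e x) × ¬ PreB b x)

  SplitSet : Fin n → Fin n → Fin n → Set
  SplitSet e b x = T (P e x) × PreB b x

  -- P_{Split(P_P, M)}: x,y lie in a common block of P that is either not split
  -- (meets M and its complement are not both true), or both lie in E'∩M, or both in E'\M.
  SplitRel : (M : Fin n → Set) → Fin n → Fin n → Set
  SplitRel M x y =
    T (P x y) ×
    ( ¬ ((Σ (Fin n) λ z → T (P x z) × M z) × (Σ (Fin n) λ z → T (P x z) × ¬ M z))
    ⊎ ((M x × M y) ⊎ (¬ M x × ¬ M y)))

  PreR : Fin n → Fin n → Set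
  PreR b d = Σ (Fin n) λ z → T (R b z) × T (t d z)

  BlockStable : (Fin n → Fin n → Set) → Set
  BlockStable S = ∀ b d d' → S d d' → (PreR b d → PreR b d') × (PreR b d' → PreR b d)

module Submission where

-- Write M = E ∩ →⁻¹(B) and r = E.rep.
--  * The refined relation P_{Split(P,M)} only ever relates P-related states, and it
--    separates r ∈ M from the state x₁ ∈ E \ M provided by the splitter, so the
--    inclusion in P is strict.  Both facts hold for an arbitrary splitting set M.
--  * Key fact: every successor z of a state of E with B R z lies in B.  Since there
--    is no type-1 splitter, (E,[z]_R) has RelCount ≠ 0: some P-block C is reached
--    from r and R-dominates a state of [z]_R.  As B R z, C is also counted by
--    RelCount(E,B); the type-2 count equality RelCount(E,B) = |{C ⊆ B | r → C}|,
--    together with the inclusion of the latter counted set in the former, forces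
--    C ⊆ B, whence z R C R B.
--  * Consequently a block-stable S ⊆ P preserves membership in M, and any
--    M-preserving symmetric S ⊆ P is contained in P_{Split(P,M)}.

open import Defs
open import Data.Nat using (ℕ; _≤_; _<_; z≤n; s≤s)
open import Data.Nat.Properties using (+-mono-≤; +-mono-<-≤; +-mono-≤-<; <⇒≢)
open import Data.Nat.ListAction using (sum)
open import Data.Fin using (Fin)
open import Data.Fin.Properties using (any?)
open import Data.Bool using (Bool; true; false; T; _∧_; _∨_; not; if_then_else_)
open import Data.Bool.Properties using (T-∧; T-∨; T-≡; T-not-≡)
open import Data.List using (List; []; _∷_; map; allFin)
open import Data.List.Relation.Unary.Any using (here; there; satisfied)
open import Data.List.Relation.Unary.Any.Properties using (any⁺; any⁻)
open import Data.List.Relation.Unary.All as All using ()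
open import Data.List.Relation.Unary.All.Properties using (all⁺)
open import Data.List.Membership.Propositional using (_∈_; lose)
open import Data.List.Membership.Propositional.Properties using (∈-allFin)
open import Data.Product using (Σ; _×_; _,_; proj₁; proj₂)
open import Data.Sum using (inj₁; inj₂)
open import Data.Empty using (⊥-elim)
open import Function.Bundles using (Equivalence)
open import Relation.Nullary using (¬_; Dec; yes; no)
open import Relation.Nullary.Decidable using (_×-dec_; T?)
open import Relation.Binary.PropositionalEquality using (_≡_; refl; sym; subst)
open import Relation.Binary.Structures using (IsEquivalence; IsPreorder)

∧-split : ∀ {a b} → T (a ∧ b) → T a × T b
∧-split = Equivalence.to T-∧

∧-pair : ∀ {a b} → T a → T b → T (a ∧ b)
∧-pair p q = Equivalence.from T-∧ (p , q)

anyF-intro : ∀ {n} (f : Fin n → Bool) x → T (f x) → T (anyF f)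
anyF-intro f x fx = any⁺ f (lose (∈-allFin x) fx)

anyF-elim : ∀ {n} (f : Fin n → Bool) → T (anyF f) → Σ (Fin n) λ x → T (f x)
anyF-elim {n} f p = satisfied (any⁻ f (allFin n) p)

allF-elim : ∀ {n} (f : Fin n → Bool) x → T (allF f) → T (f x)
allF-elim f x p = All.lookup (all⁺ f _ p) (∈-allFin x)

-- A smaller predicate has a smaller count, and
-- strictly smaller as soon as it misses an element; hence equal counts of nested
-- predicates force the predicates to agree on the list.

indicator : Bool → ℕ
indicator b = if b then 1 else 0

indicator-mono : ∀ {a b} → (T b → T a) → indicator b ≤ indicator a
indicator-mono {_}     {false} _ = z≤n
indicator-mono {true}  {true}  _ = s≤s z≤n
indicator-mono {false} {true}  h = ⊥-elim (h _)

module Counting {A : Set} where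

  count : (A → Bool) → List A → ℕ
  count f xs = sum (map (λ x → indicator (f x)) xs)

  count-witness : ∀ f xs → ¬ count f xs ≡ 0 → Σ A λ x → T (f x)
  count-witness f []       nz = ⊥-elim (nz refl)
  count-witness f (x ∷ xs) nz with f x in fx≡
  ... | true  = x , Equivalence.from T-≡ fx≡
  ... | false = count-witness f xs nz

  module _ {f g : A → Bool} (g⊆f : ∀ a → T (g a) → T (f a)) where

    count-mono : ∀ xs → count g xs ≤ count f xs
    count-mono []       = z≤n
    count-mono (x ∷ xs) = +-mono-≤ (indicator-mono (g⊆f x)) (count-mono xs)

    count-strict : ∀ {x xs} → x ∈ xs → T (f x) → ¬ T (g x) → count g xs < count f xs
    count-strict {x} {_ ∷ xs} (here refl) fx ¬gx =
      +-mono-<-≤ (missed-indicator (f x) (g x) fx ¬gx) (count-mono xs)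
      where
      missed-indicator : ∀ a b → T a → ¬ T b → indicator b < indicator a
      missed-indicator true false _ _  = s≤s z≤n
      missed-indicator _    true  _ ¬b = ⊥-elim (¬b _)
    count-strict {_} {y ∷ _} (there x∈xs) fx ¬gx =
      +-mono-≤-< (indicator-mono (g⊆f y)) (count-strict x∈xs fx ¬gx)

    count-≡⇒⊆ : ∀ {x xs} → count f xs ≡ count g xs → x ∈ xs → T (f x) → T (g x)
    count-≡⇒⊆ {x} eq x∈xs fx with T? (g x)
    ... | yes gx = gx
    ... | no ¬gx = ⊥-elim (<⇒≢ (count-strict x∈xs fx ¬gx) (sym eq))

open Counting

module _ {n : ℕ} (t R P : BRel n) (ρ : Reps P) where

  splitRel-separates : (M : Fin n → Set) → ∀ {x y} → T (P x x) → T (P x y)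
                     → M x → ¬ M y → ¬ SplitRel t R P ρ M x y
  splitRel-separates M Pxx Pxy mx ¬my (_ , inj₁ unsplit)        = unsplit ((_ , Pxx , mx) , (_ , Pxy , ¬my))
  splitRel-separates M Pxx Pxy mx ¬my (_ , inj₂ (inj₁ (_ , my))) = ¬my my
  splitRel-separates M Pxx Pxy mx ¬my (_ , inj₂ (inj₂ (¬mx , _))) = ¬mx mx

  splitRel-contains : (M : Fin n → Set) → (∀ x → Dec (M x))
                    → (S : Fin n → Fin n → Set) → (∀ {x y} → S x y → S y x)
                    → (∀ x y → S x y → T (P x y)) → (∀ {x y} → S x y → M x → M y)
                    → ∀ x y → S x y → SplitRel t R P ρ M x y
  splitRel-contains M M? S S-sym S⊆P preserves x y sxy with M? x
  ... | yes mx = S⊆P x y sxy , inj₂ (inj₁ (mx , preserves sxy mx))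
  ... | no ¬mx = S⊆P x y sxy , inj₂ (inj₂ (¬mx , λ my → ¬mx (preserves (S-sym sxy) my)))

  splitSet? : ∀ e b x → Dec (SplitSet t R P ρ e b x)
  splitSet? e b x = T? (P e x) ×-dec any? (λ y → T? (inB t R P ρ b y) ×-dec T? (t x y))

  -- The predicates on canonical states counted by RelCount(E,B) and by
  -- |{[c]_P ⊆ B | E.rep → c}|: RelCount e b ≡ countF (relatedBlock e b) holds by
  -- definition, and similarly for RepSuccBlocksInB.
  repReaches : Fin n → Fin n → Bool
  repReaches e c = anyF (λ x → P c x ∧ t (rep ρ e) x)

  relatedBlock : Fin n → Fin n → Fin n → Bool
  relatedBlock e b c = isCanon t R P ρ c ∧ repReaches e c
                       ∧ anyF (λ y → anyF (λ x → inB t R P ρ b y ∧ P c x ∧ R y x))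

  blockInside : Fin n → Fin n → Bool
  blockInside b c = allF (λ x → not (P c x) ∨ inB t R P ρ b x)

  insideSuccBlock : Fin n → Fin n → Fin n → Bool
  insideSuccBlock e b c = isCanon t R P ρ c ∧ blockInside b c ∧ repReaches e c

  blockInside-elim : ∀ {b c x} → T (blockInside b c) → T (P c x) → T (inB t R P ρ b x)
  blockInside-elim {b} {c} {x} inside Pcx
    with Equivalence.to T-∨ (allF-elim (λ x → not (P c x) ∨ inB t R P ρ b x) x inside)
  ... | inj₁ ¬Pcx = ⊥-elim (subst T (Equivalence.to T-not-≡ ¬Pcx) Pcx)
  ... | inj₂ x∈B  = x∈B

  module _ (R-preorder : IsPreorder _≡_ (λ x y → T (R x y))) where

    private
      R-refl : ∀ {x} → T (R x x)
      R-refl = IsPreorder.reflexive R-preorder refl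

      R-trans : ∀ {x y z} → T (R x y) → T (R y z) → T (R x z)
      R-trans = IsPreorder.trans R-preorder

    inB-self : ∀ b → T (inB t R P ρ b b)
    inB-self b = ∧-pair R-refl R-refl

    relatedBlock-intro : ∀ {e z c x} → T (isCanon t R P ρ c) → T (repReaches e c)
                       → T (P c x) → T (R z x) → T (relatedBlock e z c)
    relatedBlock-intro {z = z} {c} {x} canon reach Pcx Rzx =
      ∧-pair canon (∧-pair reach
        (anyF-intro (λ y → anyF (λ x → inB t R P ρ z y ∧ P c x ∧ R y x)) z
          (anyF-intro (λ x → inB t R P ρ z z ∧ P c x ∧ R z x) x
            (∧-pair (inB-self z) (∧-pair Pcx Rzx)))))

    relatedBlock-dominates : ∀ {e z c} → T (relatedBlock e z c)
                           → Σ (Fin n) λ x → T (P c x) × T (R z x)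
    relatedBlock-dominates {z = z} {c} related =
      let y , some-x       = anyF-elim (λ y → anyF (λ x → inB t R P ρ z y ∧ P c x ∧ R y x))
                                       (proj₂ (∧-split (proj₂ (∧-split {isCanon t R P ρ c} related))))
          x , y-x          = anyF-elim (λ x → inB t R P ρ z y ∧ P c x ∧ R y x) some-x
          y∈[z] , Pcx∧Ryx  = ∧-split {inB t R P ρ z y} y-x
          Pcx , Ryx        = ∧-split {P c x} Pcx∧Ryx
      in x , Pcx , R-trans (proj₁ (∧-split {R z y} y∈[z])) Ryx

    relatedBlock-lower : ∀ {e b z c} → T (R b z) → T (relatedBlock e z c) → T (relatedBlock e b c)
    relatedBlock-lower {e} {c = c} Rbz related =
      let canon , rest  = ∧-split {isCanon t R P ρ c} related
          x , Pcx , Rzx = relatedBlock-dominates related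
      in relatedBlock-intro canon (proj₁ (∧-split {repReaches e c} rest)) Pcx (R-trans Rbz Rzx)

    inside⇒related : ∀ e b c → T (insideSuccBlock e b c) → T (relatedBlock e b c)
    inside⇒related e b c inside =
      let canon , rest  = ∧-split {isCanon t R P ρ c} inside
          ⊆B , reach    = ∧-split {blockInside b c} rest
          y , Pcy∧r→y   = anyF-elim _ reach
          Pcy           = proj₁ (∧-split {P c y} Pcy∧r→y)
      in relatedBlock-intro canon reach Pcy (proj₁ (∧-split {R b y} (blockInside-elim ⊆B Pcy)))

    related⇒inside : ∀ {e b c} → RelCount t R P ρ e b ≡ RepSuccBlocksInB t R P ρ e b
                   → T (relatedBlock e b c) → T (blockInside b c)
    related⇒inside {e} {b} {c} counts related =
      let inside = count-≡⇒⊆ (inside⇒related e b) counts (∈-allFin c) related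
      in proj₁ (∧-split (proj₂ (∧-split {isCanon t R P ρ c} inside)))

    successor-in-B : (∀ e b → ¬ SplitterType1 t R P ρ e b)
                   → ∀ {e b} → RelCount t R P ρ e b ≡ RepSuccBlocksInB t R P ρ e b
                   → ∀ {y z} → T (P e y) → T (t y z) → T (R b z) → T (inB t R P ρ b z)
    successor-in-B noType1 {e} {b} counts {y} {z} Pey y→z Rbz =
      let E→[z] = y , z , Pey , inB-self z , y→z
          c , related   = count-witness (relatedBlock e z) (allFin n)
                            (λ noneCounted → noType1 e z (E→[z] , noneCounted))
          x , Pcx , Rzx = relatedBlock-dominates related
          x∈B           = blockInside-elim (related⇒inside counts (relatedBlock-lower Rbz related)) Pcx
      in ∧-pair Rbz (R-trans Rzx (proj₂ (∧-split {R b x} x∈B)))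

    splitSet-preserved : IsEquivalence (λ x y → T (P x y)) → (∀ e b → ¬ SplitterType1 t R P ρ e b)
                       → ∀ {e b} → RelCount t R P ρ e b ≡ RepSuccBlocksInB t R P ρ e b
                       → (S : Fin n → Fin n → Set) → (∀ x y → S x y → T (P x y))
                       → BlockStable t R P ρ S
                       → ∀ {x y} → S x y → SplitSet t R P ρ e b x → SplitSet t R P ρ e b y
    splitSet-preserved P-equiv noType1 {e} {b} counts S S⊆P stable {x} {y} sxy (Pex , z , z∈B , x→z) =
      let z′ , Rbz′ , y→z′ = proj₁ (stable b x y sxy) (z , proj₁ (∧-split {R b z} z∈B) , x→z)
          Pey              = IsEquivalence.trans P-equiv Pex (S⊆P x y sxy)
      in Pey , z′ , successor-in-B noType1 counts Pey y→z′ Rbz′ , y→z′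

lemma6 : ∀ {n : ℕ} (t R P : BRel n) (ρ : Reps P)
         → IsPreorder _≡_ (λ x y → T (R x y))
         → IsEquivalence (λ x y → T (P x y))
         → (∀ x y → T (P x y) → T (R x y))
         → (∀ e b → ¬ SplitterType1 t R P ρ e b)
         → (e b : Fin n) → SplitterType2 t R P ρ e b
         → (∀ x y → SplitRel t R P ρ (SplitSet t R P ρ e b) x y → T (P x y))
           × (Σ (Fin n) λ x → Σ (Fin n) λ y → T (P x y) × ¬ SplitRel t R P ρ (SplitSet t R P ρ e b) x y)
           × (∀ (S : Fin n → Fin n → Set) → IsEquivalence S
              → (∀ x y → S x y → T (P x y)) → BlockStable t R P ρ S
              → ∀ x y → S x y → SplitRel t R P ρ (SplitSet t R P ρ e b) x y)
lemma6 t R P ρ R-preorder P-equiv _ noType1 e b ((y₀ , y₀∈B , r→y₀) , counts , (x₁ , Pex₁ , x₁∉pre)) =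
  (λ _ _ → proj₁) , (r , x₁ , Prx₁ , r≁x₁) , refines
  where
  module P≈ = IsEquivalence P-equiv
  M = SplitSet t R P ρ e b
  r = rep ρ e

  -- E.rep ∈ M and x₁ ∈ E \ M lie in the same P-block but are separated by the split.
  Prx₁ : T (P r x₁)
  Prx₁ = P≈.trans (P≈.sym (rep-in ρ e)) Pex₁

  r≁x₁ : ¬ SplitRel t R P ρ M r x₁
  r≁x₁ = splitRel-separates t R P ρ M P≈.refl Prx₁ (rep-in ρ e , y₀ , y₀∈B , r→y₀) (λ x₁∈M → x₁∉pre (proj₂ x₁∈M))

  refines : ∀ (S : _ → _ → Set) → IsEquivalence S → (∀ x y → S x y → T (P x y))
          → BlockStable t R P ρ S → ∀ x y → S x y → SplitRel t R P ρ M x y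
  refines S S-equiv S⊆P stable =
    splitRel-contains t R P ρ M (splitSet? t R P ρ e b) S (IsEquivalence.sym S-equiv) S⊆P
      (splitSet-preserved t R P ρ R-preorder P-equiv noType1 counts S S⊆P stable)
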